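{- Let $t(x)$ be a unary term and $\mathbf{A}\in\{\mathbf{S}_{1,1},\mathbf{S}_{1,\omega}\}$. If $t^{\mathbf{A}}$ is a nucleus on $\mathbf{A}$ and $t^{\mathbf{A}}(\bot)=\bot$, then $\mathbf{A}\models t(x)\approx s(x)$ for some $s(x)\in\{x,\neg\neg x\}$.
   Context: Terms are in the language $\{\wedge,\vee,\cdot,\to,\bot,\top\}$ of residuated lattices; $\neg x:=x\to\bot$. A nucleus on a residuated lattice $\mathbf{A}$ is a map $\gamma:A\to A$ with $a\le\gamma(a)$, $a\le b\Rightarrow\gamma(a)\le\gamma(b)$, $\gamma(\gamma(a))=\gamma(a)$, $\gamma(a)\gamma(b)\le\gamma(ab)$. $\mathbf{S}_{1,1}$ is the three-element BL-chain $\bot<c<\top$ with $c\cdot c=c$, $c\cdot\bot=\bot$, $c\to\bot=\bot$, and $x\to y=\top$ whenever $x\le y$ (the ordinal sum $(\mathbf{S}_1\oplus\mathbf{S}_1)^+$ of two copies of the two-element idempotent hoop). $\mathbf{S}_{1,\omega}=(\mathbf{S}_1\oplus\mathbf{S}_\omega)^+$ is the BL-chain with universe $\{\bot\}\cup\{a^k:k\in\omega\}$ ($a^0=\top$), ordered by $\bot<a^k$ and $a^k\le a^j$ iff $k\ge j$, with $a^ka^j=a^{k+j}$, $a^k\to a^j=a^{\max(j-k,0)}$, $\bot\cdot x=\bot$, $a^k\to\bot=\bot$ for $k\ge1$, $\top\to\bot=\bot$, $\bot\to x=\top$; lattice operations are min and max. -}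

module Defs where

open import Data.Nat using (ℕ; zero; suc; _+_; _∸_; _⊔_; _⊓_; _≤ᵇ_)
open import Data.Bool using (Bool; true; false; if_then_else_)
open import Data.Product using (Σ; _×_; ∃)
open import Data.Sum using (_⊎_)
open import Relation.Binary.PropositionalEquality using (_≡_)

data Term : Set where
  var  : Term
  _∧ₜ_ _∨ₜ_ _·ₜ_ _⇒ₜ_ : Term → Term → Term
  ⊥ₜ ⊤ₜ : Term

¬ₜ_ : Term → Term
¬ₜ t = t ⇒ₜ ⊥ₜ

record RLAlg : Set₁ where
  field
    Carrier : Set
    _∧_ _∨_ _·_ _⇒_ : Carrier → Carrier → Carrier
    bot top : Carrier

  _≤_ : Carrier → Carrier → Set
  a ≤ b = (a ∧ b) ≡ a

eval : (A : RLAlg) → Term → RLAlg.Carrier A → RLAlg.Carrier A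
eval A var a = a
eval A (s ∧ₜ t) a = RLAlg._∧_ A (eval A s a) (eval A t a)
eval A (s ∨ₜ t) a = RLAlg._∨_ A (eval A s a) (eval A t a)
eval A (s ·ₜ t) a = RLAlg._·_ A (eval A s a) (eval A t a)
eval A (s ⇒ₜ t) a = RLAlg._⇒_ A (eval A s a) (eval A t a)
eval A ⊥ₜ a = RLAlg.bot A
eval A ⊤ₜ a = RLAlg.top A

record IsNucleus (A : RLAlg) (γ : RLAlg.Carrier A → RLAlg.Carrier A) : Set where
  open RLAlg A
  field
    extensive  : ∀ a → a ≤ γ a
    monotone   : ∀ a b → a ≤ b → γ a ≤ γ b
    idempotent : ∀ a → γ (γ a) ≡ γ a
    mult       : ∀ a b → (γ a · γ b) ≤ γ (a · b)

_⊨_≈_ : RLAlg → Term → Term → Set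
A ⊨ s ≈ t = ∀ a → eval A s a ≡ eval A t a

-- S_{1,1}: the three-element BL-chain ⊥ < c < ⊤ (3-element Gödel chain)

data S11 : Set where
  b3 c3 t3 : S11

rank3 : S11 → ℕ
rank3 b3 = 0
rank3 c3 = 1
rank3 t3 = 2

meet3 : S11 → S11 → S11
meet3 x y = if rank3 x ≤ᵇ rank3 y then x else y

join3 : S11 → S11 → S11
join3 x y = if rank3 x ≤ᵇ rank3 y then y else x

-- c·c = c, c·⊥ = ⊥, ⊤ neutral: multiplication is min
mul3 : S11 → S11 → S11
mul3 = meet3

imp3 : S11 → S11 → S11
imp3 x y = if rank3 x ≤ᵇ rank3 y then t3 else y

𝐒₁₁ : RLAlg
𝐒₁₁ = record
  { Carrier = S11 ; _∧_ = meet3 ; _∨_ = join3 ; _·_ = mul3 ; _⇒_ = imp3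
  ; bot = b3 ; top = t3 }

-- S_{1,ω}: universe {⊥} ∪ {a^k : k ∈ ω}, a^0 = ⊤, ⊥ < a^k, a^k ≤ a^j iff k ≥ j

data S1ω : Set where
  bω  : S1ω
  pw  : ℕ → S1ω      -- pw k = a^k

meetω : S1ω → S1ω → S1ω
meetω bω y = bω
meetω (pw k) bω = bω
meetω (pw k) (pw j) = pw (k ⊔ j)

joinω : S1ω → S1ω → S1ω
joinω bω y = y
joinω (pw k) bω = pw k
joinω (pw k) (pw j) = pw (k ⊓ j)

mulω : S1ω → S1ω → S1ω
mulω bω y = bω
mulω (pw k) bω = bω
mulω (pw k) (pw j) = pw (k + j)

impω : S1ω → S1ω → S1ω
impω bω y = pw 0
impω (pw k) bω = bω
impω (pw k) (pw j) = pw (j ∸ k)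

𝐒₁ω : RLAlg
𝐒₁ω = record
  { Carrier = S1ω ; _∧_ = meetω ; _∨_ = joinω ; _·_ = mulω ; _⇒_ = impω
  ; bot = bω ; top = pw 0 }

data Which : Set where
  s11 s1ω : Which

alg : Which → RLAlg
alg s11 = 𝐒₁₁
alg s1ω = 𝐒₁ω

{-# OPTIONS --safe #-}
module Submission where

-- Only extensivity of t and t(⊥) = ⊥ are needed.  On S₁,₁ extensivity
-- forces t(⊤) = ⊤ and t(c) ∈ {c, ⊤}.  On S₁,ω every map a^j ↦ a^(jk),
-- ⊥ ↦ ⊥ is an endomorphism sending a to a^k, so term functions commute
-- with it and are determined by their values at ⊥ and a; extensivity
-- forces t(a) ∈ {a, ⊤}, and these are the values of x and ¬¬x at a.

open import Defs
open import Data.Nat using (ℕ; suc; _*_)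
open import Data.Nat.Properties using (*-distribʳ-⊔; *-distribʳ-⊓; *-distribʳ-+; *-distribʳ-∸; *-identityˡ)
open import Data.Product using (Σ; _×_; _,_)
open import Data.Sum using (_⊎_; inj₁; inj₂)
open import Relation.Binary.PropositionalEquality using (_≡_; refl; sym; trans; cong; cong₂; module ≡-Reasoning)

record IsHomomorphism (A B : RLAlg) (h : RLAlg.Carrier A → RLAlg.Carrier B) : Set where
  private
    module A = RLAlg A
    module B = RLAlg B
  field
    ∧-homo   : ∀ a b → h (a A.∧ b) ≡ h a B.∧ h b
    ∨-homo   : ∀ a b → h (a A.∨ b) ≡ h a B.∨ h b
    ·-homo   : ∀ a b → h (a A.· b) ≡ h a B.· h b
    ⇒-homo   : ∀ a b → h (a A.⇒ b) ≡ h a B.⇒ h b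
    bot-homo : h A.bot ≡ B.bot
    top-homo : h A.top ≡ B.top

eval-homo : ∀ {A B h} → IsHomomorphism A B h →
            ∀ t a → eval B t (h a) ≡ h (eval A t a)
eval-homo {A} {B} {h} hom = go
  where
  open IsHomomorphism hom
  go : ∀ t a → eval B t (h a) ≡ h (eval A t a)
  go var      a = refl
  go (s ∧ₜ t) a = trans (cong₂ (RLAlg._∧_ B) (go s a) (go t a)) (sym (∧-homo _ _))
  go (s ∨ₜ t) a = trans (cong₂ (RLAlg._∨_ B) (go s a) (go t a)) (sym (∨-homo _ _))
  go (s ·ₜ t) a = trans (cong₂ (RLAlg._·_ B) (go s a) (go t a)) (sym (·-homo _ _))
  go (s ⇒ₜ t) a = trans (cong₂ (RLAlg._⇒_ B) (go s a) (go t a)) (sym (⇒-homo _ _))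
  go ⊥ₜ       a = sym bot-homo
  go ⊤ₜ       a = sym top-homo

witness-var-or-¬¬var : ∀ {A} t → (A ⊨ t ≈ var) ⊎ (A ⊨ t ≈ (¬ₜ (¬ₜ var))) →
                       Σ Term (λ s → (s ≡ var ⊎ s ≡ ¬ₜ (¬ₜ var)) × (A ⊨ t ≈ s))
witness-var-or-¬¬var t (inj₁ t≈x)   = var , inj₁ refl , t≈x
witness-var-or-¬¬var t (inj₂ t≈¬¬x) = ¬ₜ (¬ₜ var) , inj₂ refl , t≈¬¬x

module S₁₁ = RLAlg 𝐒₁₁

c≤⇒≡c⊎≡⊤ : ∀ y → c3 S₁₁.≤ y → y ≡ c3 ⊎ y ≡ t3
c≤⇒≡c⊎≡⊤ b3 ()
c≤⇒≡c⊎≡⊤ c3 _ = inj₁ refl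
c≤⇒≡c⊎≡⊤ t3 _ = inj₂ refl

⊤≤⇒≡⊤ : ∀ y → t3 S₁₁.≤ y → y ≡ t3
⊤≤⇒≡⊤ b3 ()
⊤≤⇒≡⊤ c3 ()
⊤≤⇒≡⊤ t3 _ = refl

S₁₁-extensive-term : ∀ t → (∀ a → a S₁₁.≤ eval 𝐒₁₁ t a) → eval 𝐒₁₁ t b3 ≡ b3 →
                     (𝐒₁₁ ⊨ t ≈ var) ⊎ (𝐒₁₁ ⊨ t ≈ (¬ₜ (¬ₜ var)))
S₁₁-extensive-term t ext t⊥≡⊥
  with c≤⇒≡c⊎≡⊤ (eval 𝐒₁₁ t c3) (ext c3) | ⊤≤⇒≡⊤ (eval 𝐒₁₁ t t3) (ext t3)
... | inj₁ tc≡c | t⊤≡⊤ = inj₁ λ { b3 → t⊥≡⊥ ; c3 → tc≡c ; t3 → t⊤≡⊤ }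
... | inj₂ tc≡⊤ | t⊤≡⊤ = inj₂ λ { b3 → t⊥≡⊥ ; c3 → tc≡⊤ ; t3 → t⊤≡⊤ }

module S₁ω = RLAlg 𝐒₁ω

scale : ℕ → S1ω → S1ω
scale k bω     = bω
scale k (pw j) = pw (j * k)

scale-isHomomorphism : ∀ k → IsHomomorphism 𝐒₁ω 𝐒₁ω (scale k)
scale-isHomomorphism k = record
  { ∧-homo   = λ { bω _ → refl ; (pw i) bω → refl ; (pw i) (pw j) → cong pw (*-distribʳ-⊔ k i j) }
  ; ∨-homo   = λ { bω _ → refl ; (pw i) bω → refl ; (pw i) (pw j) → cong pw (*-distribʳ-⊓ k i j) }
  ; ·-homo   = λ { bω _ → refl ; (pw i) bω → refl ; (pw i) (pw j) → cong pw (*-distribʳ-+ k i j) }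
  ; ⇒-homo   = λ { bω _ → refl ; (pw i) bω → refl ; (pw i) (pw j) → cong pw (*-distribʳ-∸ k j i) }
  ; bot-homo = refl
  ; top-homo = refl
  }

eval-pw : ∀ t k → eval 𝐒₁ω t (pw k) ≡ scale k (eval 𝐒₁ω t (pw 1))
eval-pw t k = begin
  eval 𝐒₁ω t (pw k)             ≡⟨ cong (λ j → eval 𝐒₁ω t (pw j)) (sym (*-identityˡ k)) ⟩
  eval 𝐒₁ω t (scale k (pw 1))   ≡⟨ eval-homo (scale-isHomomorphism k) t (pw 1) ⟩
  scale k (eval 𝐒₁ω t (pw 1))   ∎
  where open ≡-Reasoning

S₁ω-≈-from-⊥-and-a : ∀ t s → eval 𝐒₁ω t bω ≡ eval 𝐒₁ω s bω →
                     eval 𝐒₁ω t (pw 1) ≡ eval 𝐒₁ω s (pw 1) → 𝐒₁ω ⊨ t ≈ s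
S₁ω-≈-from-⊥-and-a t s t⊥≡s⊥ ta≡sa bω     = t⊥≡s⊥
S₁ω-≈-from-⊥-and-a t s t⊥≡s⊥ ta≡sa (pw k) = begin
  eval 𝐒₁ω t (pw k)             ≡⟨ eval-pw t k ⟩
  scale k (eval 𝐒₁ω t (pw 1))   ≡⟨ cong (scale k) ta≡sa ⟩
  scale k (eval 𝐒₁ω s (pw 1))   ≡⟨ eval-pw s k ⟨
  eval 𝐒₁ω s (pw k)             ∎
  where open ≡-Reasoning

a≤⇒≡a⊎≡⊤ : ∀ y → pw 1 S₁ω.≤ y → y ≡ pw 1 ⊎ y ≡ pw 0
a≤⇒≡a⊎≡⊤ bω                 ()
a≤⇒≡a⊎≡⊤ (pw 0)             _ = inj₂ refl
a≤⇒≡a⊎≡⊤ (pw 1)             _ = inj₁ refl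
a≤⇒≡a⊎≡⊤ (pw (suc (suc j))) ()

S₁ω-extensive-term : ∀ t → (∀ a → a S₁ω.≤ eval 𝐒₁ω t a) → eval 𝐒₁ω t bω ≡ bω →
                     (𝐒₁ω ⊨ t ≈ var) ⊎ (𝐒₁ω ⊨ t ≈ (¬ₜ (¬ₜ var)))
S₁ω-extensive-term t ext t⊥≡⊥ with a≤⇒≡a⊎≡⊤ (eval 𝐒₁ω t (pw 1)) (ext (pw 1))
... | inj₁ ta≡a = inj₁ (S₁ω-≈-from-⊥-and-a t var t⊥≡⊥ ta≡a)
... | inj₂ ta≡⊤ = inj₂ (S₁ω-≈-from-⊥-and-a t (¬ₜ (¬ₜ var)) t⊥≡⊥ ta≡⊤)

mainTheorem17 : (w : Which) (t : Term) →
    IsNucleus (alg w) (eval (alg w) t) →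
    eval (alg w) t (RLAlg.bot (alg w)) ≡ RLAlg.bot (alg w) →
    Σ Term (λ s → (s ≡ var ⊎ s ≡ ¬ₜ (¬ₜ var)) × (alg w ⊨ t ≈ s))
mainTheorem17 s11 t γ t⊥≡⊥ =
  witness-var-or-¬¬var t (S₁₁-extensive-term t (IsNucleus.extensive γ) t⊥≡⊥)
mainTheorem17 s1ω t γ t⊥≡⊥ =
  witness-var-or-¬¬var t (S₁ω-extensive-term t (IsNucleus.extensive γ) t⊥≡⊥)
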